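{- Let $T=(\Sigma,Q,q_0,q_f,\delta)$ be a Turing machine. Let $n\ge 2$, $q\in Q$, $s=a_1\ldots a_n\in\Sigma^n$ and $p\in\{1,\ldots,n\}$. Then the configuration $(q,p,s)$ is accepting in $T$ using at most $n$ tape cells if and only if there exists a $\lambda$-term $e$ such that $\Gamma_p\vdash e:\langle q,a_p\rangle$ and $\Gamma_i\vdash e: a_i$ for all $i\in\{1,\ldots,n\}\setminus\{p\}$, where $\Gamma=\{x_f:\sigma_f\}\cup\{x_t:\sigma_t \mid t\in\delta\}$, $\Gamma_1=\Gamma\cup\{y_1:l\}\cup\{y_j:\bullet\mid j\in\{2,\ldots,n-1\}\}$, $\Gamma_i=\Gamma\cup\{y_{i-1}:r,\ y_i:l\}\cup\{y_j:\bullet\mid j\in\{1,\ldots,n-1\}\setminus\{i-1,i\}\}$ for $i\in\{2,\ldots,n-1\}$, $\Gamma_n=\Gamma\cup\{y_{n-1}:r\}\cup\{y_j:\bullet\mid j\in\{1,\ldots,n-2\}\}$, with $\sigma_f=\bigcap_{c\in\Sigma}\langle q_f,c\rangle\cap\bigcap_{c\in\Sigma} c$, and for each transition $t$: if $t$ is $\delta(q,c)=(q',c',+1)$ then $\sigma_t=\bigcap_{a\in\Sigma}(\bullet\to a\to a)\cap(l\to c'\to\langle q,c\rangle)\cap\bigcap_{a\in\Sigma}(r\to\langle q',a\rangle\to a)$, and if $t$ is $\delta(q,c)=(q',c',-1)$ then $\sigma_t=\bigcap_{a\in\Sigma}(\bullet\to a\to a)\cap(r\to c'\to\langle q,c\rangle)\cap\bigcap_{a\in\Sigma}(l\to\langle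 q',a\rangle\to a)$.
   Context: A Turing machine $T=(\Sigma,Q,q_0,q_f,\delta)$ has a finite nonempty tape alphabet $\Sigma$, finite nonempty state set $Q$, initial state $q_0$, final state $q_f$, and transition function $\delta:(Q\setminus\{q_f\})\times\Sigma\to Q\times\Sigma\times\{+1,-1\}$; a transition $t\in\delta$ is a single entry $(q,c)\mapsto(q',c',d)$. A configuration is $(q,p,a_1\ldots a_n)$ with head position $p\in\{1,\ldots,n\}$. If $q\neq q_f$ and $\delta(q,a_p)=(q',c',d)$ with $p+d\in\{1,\ldots,n\}$, the next configuration is $(q',p+d,a_1\ldots a_{p-1}c'a_{p+1}\ldots a_n)$. The configuration $(q,p,s)$ is accepting using at most $n$ tape cells if a finite sequence of such steps (all head positions staying in $\{1,\ldots,n\}$) leads to a configuration with state $q_f$. Type atoms: the set $\mathbb{A}$ is the disjoint union of $\Sigma$, $\{l,r,\bullet\}$, $\{\langle q,a\rangle\mid q\in Q,a\in\Sigma\}$ and $\{\circ,*,\#,\$\}$. Intersection types: $\sigma,\tau::=a\mid\sigma\to\tau\mid\sigma\cap\tau$ ($a\in\mathbb{A}$), $\to$ right-associative, $\cap$ binds stronger than $\to$ and is idempotent, commutative, associative. $\lambda$-terms and typing rules: (Ax) $\Gamma,x:\sigma\vdash x:\sigma$; ($\to$I) from $\Gamma,x:\sigma\vdash M:\tau$ infer $\Gamma\vdash\lambda x.M:\sigma\to\tau$; ($\to$E) from $\Gamma\vdash M:\sigma\to\tau$ and $\Gamma\vdash N:\sigma$ infer $\Gamma\vdash MN:\tau$;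 ($\cap$I) from $\Gamma\vdash M:\sigma$ and $\Gamma\vdash M:\tau$ infer $\Gamma\vdash M:\sigma\cap\tau$; ($\cap$E) from $\Gamma\vdash M:\sigma\cap\tau$ infer $\Gamma\vdash M:\sigma$. -}

module Defs where

open import Data.Nat using (ℕ; zero; suc; _+_; _∸_; _<_)
open import Data.Nat.Properties using (_<?_)
open import Data.Fin using (Fin; toℕ)
import Data.Fin.Properties as FinP
import Data.Nat.Properties as NatP
open import Data.Vec using (Vec; lookup; _[_]≔_)
open import Data.Maybe using (Maybe; just; nothing)
open import Data.Product using (_×_; _,_; ∃)
open import Relation.Binary.PropositionalEquality using (_≡_; _≢_; refl; cong)
open import Relation.Nullary using (Dec; yes; no; ¬_)
open import Relation.Binary.Construct.Closure.ReflexiveTransitive using (Star)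

data Dir : Set where
  plus1 minus1 : Dir

-- The tape alphabet is Fin (suc nΣ) and the state set is
-- Fin (suc nQ) (finite nonempty sets, up to bijection).  δ is given as a total
-- function, but only its entries (q , c) with q ≢ qf are transitions of T
-- (δ is defined on (Q \ {qf}) × Σ in the paper; values at qf are ignored).
record TM : Set where
  field
    nΣ nQ : ℕ
    q0 qf : Fin (suc nQ)
    δ     : Fin (suc nQ) → Fin (suc nΣ) → Fin (suc nQ) × Fin (suc nΣ) × Dir

Sym : TM → Set
Sym T = Fin (suc (TM.nΣ T))

State : TM → Set
State T = Fin (suc (TM.nQ T))

record Config (T : TM) (n : ℕ) : Set where
  constructor cfg
  field
    state : State T
    pos   : Fin n
    tape  : Vec (Sym T) n

-- one step; positions are 0-based Fin n (paper: 1..n)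
data Step (T : TM) {n : ℕ} : Config T n → Config T n → Set where
  stepR : ∀ {q p s q' c' p'} → q ≢ TM.qf T →
          TM.δ T q (lookup s p) ≡ (q' , c' , plus1) →
          toℕ p' ≡ suc (toℕ p) →
          Step T (cfg q p s) (cfg q' p' (s [ p ]≔ c'))
  stepL : ∀ {q p s q' c' p'} → q ≢ TM.qf T →
          TM.δ T q (lookup s p) ≡ (q' , c' , minus1) →
          suc (toℕ p') ≡ toℕ p →
          Step T (cfg q p s) (cfg q' p' (s [ p ]≔ c'))

Accepting : (T : TM) {n : ℕ} → State T → Fin n → Vec (Sym T) n → Set
Accepting T {n} q p s =
  ∃ λ (c : Config T n) → Star (Step T) (cfg q p s) c × Config.state c ≡ TM.qf T

data Atom (T : TM) : Set where
  sym   : Sym T → Atom T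
  l r • : Atom T
  st    : State T → Sym T → Atom T
  ∘ ⋆ ♯ $ : Atom T

infixr 5 _⇒_
infixl 6 _∩_
data Ty (T : TM) : Set where
  atom : Atom T → Ty T
  _⇒_  : Ty T → Ty T → Ty T
  _∩_  : Ty T → Ty T → Ty T

data _≈ᵀ_ {T : TM} : Ty T → Ty T → Set where
  ≈refl  : ∀ {σ} → σ ≈ᵀ σ
  ≈sym   : ∀ {σ τ} → σ ≈ᵀ τ → τ ≈ᵀ σ
  ≈trans : ∀ {σ τ ρ} → σ ≈ᵀ τ → τ ≈ᵀ ρ → σ ≈ᵀ ρ
  ≈⇒     : ∀ {σ σ' τ τ'} → σ ≈ᵀ σ' → τ ≈ᵀ τ' → (σ ⇒ τ) ≈ᵀ (σ' ⇒ τ')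
  ≈∩     : ∀ {σ σ' τ τ'} → σ ≈ᵀ σ' → τ ≈ᵀ τ' → (σ ∩ τ) ≈ᵀ (σ' ∩ τ')
  ∩-idem  : ∀ {σ} → (σ ∩ σ) ≈ᵀ σ
  ∩-comm  : ∀ {σ τ} → (σ ∩ τ) ≈ᵀ (τ ∩ σ)
  ∩-assoc : ∀ {σ τ ρ} → ((σ ∩ τ) ∩ ρ) ≈ᵀ (σ ∩ (τ ∩ ρ))

⋂ : ∀ {T k} → (Fin (suc k) → Ty T) → Ty T
⋂ {k = zero}  f = f Fin.zero
⋂ {k = suc k} f = f Fin.zero ∩ ⋂ (λ i → f (Fin.suc i))

data Name (T : TM) : Set where
  xf : Name T
  xt : State T → Sym T → Name T      -- x_t for t = (q , c)
  y  : ℕ → Name T                    -- y_j (0-based: paper's y_{j+1})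
  v  : ℕ → Name T

_≟N_ : ∀ {T} (a b : Name T) → Dec (a ≡ b)
xf ≟N xf = yes refl
xf ≟N xt _ _ = no λ ()
xf ≟N y _ = no λ ()
xf ≟N v _ = no λ ()
xt _ _ ≟N xf = no λ ()
xt q c ≟N xt q' c' with q FinP.≟ q' | c FinP.≟ c'
... | yes refl | yes refl = yes refl
... | no ne | _ = no λ { refl → ne refl }
... | yes _ | no ne = no λ { refl → ne refl }
xt _ _ ≟N y _ = no λ ()
xt _ _ ≟N v _ = no λ ()
y _ ≟N xf = no λ ()
y _ ≟N xt _ _ = no λ ()
y i ≟N y j with i NatP.≟ j
... | yes refl = yes refl
... | no ne = no λ { refl → ne refl }
y _ ≟N v _ = no λ ()
v _ ≟N xf = no λ ()
v _ ≟N xt _ _ = no λ ()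
v _ ≟N y _ = no λ ()
v i ≟N v j with i NatP.≟ j
... | yes refl = yes refl
... | no ne = no λ { refl → ne refl }

data Term (T : TM) : Set where
  var : Name T → Term T
  lam : Name T → Term T → Term T
  app : Term T → Term T → Term T

Ctx : TM → Set
Ctx T = Name T → Maybe (Ty T)

_,_∶_ : ∀ {T} → Ctx T → Name T → Ty T → Ctx T
(Γ , x ∶ σ) z with z ≟N x
... | yes _ = just σ
... | no _  = Γ z

infix 4 _⊢_∶_
data _⊢_∶_ {T : TM} (Γ : Ctx T) : Term T → Ty T → Set where
  ax   : ∀ {x σ} → Γ x ≡ just σ → Γ ⊢ var x ∶ σ
  →I   : ∀ {x σ τ M} → (Γ , x ∶ σ) ⊢ M ∶ τ → Γ ⊢ lam x M ∶ σ ⇒ τ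
  →E   : ∀ {σ τ M N} → Γ ⊢ M ∶ σ ⇒ τ → Γ ⊢ N ∶ σ → Γ ⊢ app M N ∶ τ
  ∩I   : ∀ {σ τ M} → Γ ⊢ M ∶ σ → Γ ⊢ M ∶ τ → Γ ⊢ M ∶ σ ∩ τ
  ∩E₁  : ∀ {σ τ M} → Γ ⊢ M ∶ σ ∩ τ → Γ ⊢ M ∶ σ
  ∩E₂  : ∀ {σ τ M} → Γ ⊢ M ∶ σ ∩ τ → Γ ⊢ M ∶ τ
  conv : ∀ {σ τ M} → Γ ⊢ M ∶ σ → σ ≈ᵀ τ → Γ ⊢ M ∶ τ

module _ (T : TM) where
  open TM T

  σf : Ty T
  σf = ⋂ (λ c → atom (st qf c)) ∩ ⋂ (λ c → atom (sym c))

  σtrans : (q' : State T) (c' : Sym T) (d : Dir) (q : State T) (c : Sym T) → Ty T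
  σtrans q' c' plus1 q c =
    ⋂ (λ a → atom • ⇒ atom (sym a) ⇒ atom (sym a))
    ∩ (atom l ⇒ atom (sym c') ⇒ atom (st q c))
    ∩ ⋂ (λ a → atom r ⇒ atom (st q' a) ⇒ atom (sym a))
  σtrans q' c' minus1 q c =
    ⋂ (λ a → atom • ⇒ atom (sym a) ⇒ atom (sym a))
    ∩ (atom r ⇒ atom (sym c') ⇒ atom (st q c))
    ∩ ⋂ (λ a → atom l ⇒ atom (st q' a) ⇒ atom (sym a))

  σt : State T → Sym T → Ty T
  σt q c with δ q c
  ... | (q' , c' , d) = σtrans q' c' d q c

  Γ₀ : Ctx T
  Γ₀ xf = just σf
  Γ₀ (xt q c) with q FinP.≟ qf
  ... | yes _ = nothing
  ... | no _  = just (σt q c)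
  Γ₀ (y _) = nothing
  Γ₀ (v _) = nothing

  -- Variables y_j, j = 0..n-2 (paper's
  -- y_{j+1}) sit between cells j and j+1:  y_{i-1} : r, y_i : l, others : •.
  Γᵢ : (n : ℕ) → Fin n → Ctx T
  Γᵢ n i (y j) with j <? n ∸ 1
  ... | no _ = nothing
  ... | yes _ with suc j NatP.≟ toℕ i
  ...   | yes _ = just (atom r)
  ...   | no _ with j NatP.≟ toℕ i
  ...     | yes _ = just (atom l)
  ...     | no _  = just (atom •)
  Γᵢ n i xf       = Γ₀ xf
  Γᵢ n i (xt q c) = Γ₀ (xt q c)
  Γᵢ n i (v k)    = Γ₀ (v k)

-- Forward, by induction on the run: if the first step applies t = δ(q, a_p) and moves the head
-- across the wire y_j, the configuration is typed by x_t y_j e, where e types the successor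
-- configuration; the three components of σ_t type this term at the departure cell, the arrival
-- cell and every other cell.
-- Backward, by realizability: interpret every variable by itself (a neutral value) and let an
-- atom at cell i be realized by those neutral values that spell out an accepting run as seen
-- from cell i. Intersection typing is sound for this interpretation, so e evaluates to a
-- realizer of each of its n types; since evaluation is deterministic these are realizers for
-- one and the same value, from which the run is read off by recursion on that value.
module Submission where

open import Defs
open import Data.Nat using (ℕ; zero; suc; _≤_; _<_; _∸_; s≤s)
import Data.Nat.Properties as ℕP
open import Data.Fin using (Fin; toℕ; fromℕ<)
import Data.Fin.Properties as FinP
open import Data.Vec using (Vec; lookup; _[_]≔_)
open import Data.Vec.Properties using (lookup∘update; lookup∘update′)
open import Data.Maybe using (Maybe; just; nothing)
open import Data.Product using (∃; ∃-syntax; _×_; _,_; proj₁; proj₂; swap; assocʳ′; assocˡ′)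
open import Data.Product.Function.NonDependent.Propositional using (_×-⇔_)
open import Data.Empty using (⊥-elim)
open import Function.Base using (_∘′_)
open import Function.Bundles using (_⇔_; mk⇔; Equivalence)
import Function.Properties.Equivalence as ⇔
open import Relation.Binary.PropositionalEquality
  using (_≡_; _≢_; refl; trans; cong; subst)
  renaming (sym to ≡-sym)
open import Relation.Nullary using (yes; no; ¬_)
open import Relation.Binary.Construct.Closure.ReflexiveTransitive using (Star; ε; _◅_)

<∸1⇒suc< : ∀ {m j} → j < m ∸ 1 → suc j < m
<∸1⇒suc< {zero} ()
<∸1⇒suc< {suc m} j< = s≤s j<

suc<⇒<∸1 : ∀ {m j} → suc j < m → j < m ∸ 1
suc<⇒<∸1 {suc m} (s≤s j<) = j<

⋂-elim : ∀ {T Γ M k} {f : Fin (suc k) → Ty T} → Γ ⊢ M ∶ ⋂ f → ∀ c → Γ ⊢ M ∶ f c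
⋂-elim {k = zero} ⊢M Fin.zero = ⊢M
⋂-elim {k = suc k} ⊢M Fin.zero = ∩E₁ ⊢M
⋂-elim {k = suc k} ⊢M (Fin.suc c) = ⋂-elim (∩E₂ ⊢M) c

retype : ∀ {T} {Γ : Ctx T} {M σ τ} → σ ≡ τ → Γ ⊢ M ∶ σ → Γ ⊢ M ∶ τ
retype refl ⊢M = ⊢M

module Evaluation (T : TM) where

  mutual
    data Val : Set where
      clo : Name T → Term T → (Name T → Val) → Val
      neu : Ne → Val

    data Ne : Set where
      hd : Name T → Ne
      ap : Ne → Val → Ne

  Env : Set
  Env = Name T → Val

  _[_↦_] : Env → Name T → Val → Env
  (ρ [ x ↦ w ]) z with z ≟N x
  ... | yes _ = w
  ... | no _  = ρ z

  mutual
    data Eval : Env → Term T → Val → Set where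
      evar : ∀ {ρ x} → Eval ρ (var x) (ρ x)
      elam : ∀ {ρ x M} → Eval ρ (lam x M) (clo x M ρ)
      eapp : ∀ {ρ M N f w u} → Eval ρ M f → Eval ρ N w → Apply f w u → Eval ρ (app M N) u

    data Apply : Val → Val → Val → Set where
      aclo : ∀ {ρ x B w u} → Eval (ρ [ x ↦ w ]) B u → Apply (clo x B ρ) w u
      ane  : ∀ {m w} → Apply (neu m) w (neu (ap m w))

  mutual
    eval-deterministic : ∀ {ρ M u u'} → Eval ρ M u → Eval ρ M u' → u ≡ u'
    eval-deterministic evar evar = refl
    eval-deterministic elam elam = refl
    eval-deterministic (eapp M⇓ N⇓ f·w) (eapp M⇓' N⇓' f·w')
      with eval-deterministic M⇓ M⇓' | eval-deterministic N⇓ N⇓'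
    ... | refl | refl = apply-deterministic f·w f·w'

    apply-deterministic : ∀ {f w u u'} → Apply f w u → Apply f w u' → u ≡ u'
    apply-deterministic (aclo B⇓) (aclo B⇓') = eval-deterministic B⇓ B⇓'
    apply-deterministic ane ane = refl

module Realizability (T : TM) {W : Set} (⟦_⟧ₐ : W → Atom T → Evaluation.Val T → Set) where
  open Evaluation T
  open Equivalence using (to; from)

  ⟦_⟧ : Ty T → W → Val → Set
  ⟦ atom a ⟧ i u = ⟦ i ⟧ₐ a u
  ⟦ σ ⇒ τ ⟧ i f = ∀ w → ⟦ σ ⟧ i w → ∃[ u ] Apply f w u × ⟦ τ ⟧ i u
  ⟦ σ ∩ τ ⟧ i u = ⟦ σ ⟧ i u × ⟦ τ ⟧ i u

  ⇒-mono : ∀ {σ σ' τ τ' i f} →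
           (∀ w → ⟦ σ' ⟧ i w → ⟦ σ ⟧ i w) → (∀ u → ⟦ τ ⟧ i u → ⟦ τ' ⟧ i u) →
           ⟦ σ ⇒ τ ⟧ i f → ⟦ σ' ⇒ τ' ⟧ i f
  ⇒-mono pre post ↓f w ↓w with ↓f w (pre w ↓w)
  ... | u , f·w , ↓u = u , f·w , post u ↓u

  ≈ᵀ-sound : ∀ {σ τ} → σ ≈ᵀ τ → ∀ i u → ⟦ σ ⟧ i u ⇔ ⟦ τ ⟧ i u
  ≈ᵀ-sound ≈refl i u = ⇔.refl
  ≈ᵀ-sound (≈sym σ≈τ) i u = ⇔.sym (≈ᵀ-sound σ≈τ i u)
  ≈ᵀ-sound (≈trans σ≈τ τ≈ρ) i u = ⇔.trans (≈ᵀ-sound σ≈τ i u) (≈ᵀ-sound τ≈ρ i u)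
  ≈ᵀ-sound (≈⇒ {σ} {σ'} {τ} {τ'} σ≈σ' τ≈τ') i f = mk⇔
    (⇒-mono {σ} {σ'} {τ} {τ'} (λ w → from (dom w)) (λ u → to (cod u)))
    (⇒-mono {σ'} {σ} {τ'} {τ} (λ w → to (dom w)) (λ u → from (cod u)))
    where
      dom = ≈ᵀ-sound σ≈σ' i
      cod = ≈ᵀ-sound τ≈τ' i
  ≈ᵀ-sound (≈∩ σ≈σ' τ≈τ') i u = ≈ᵀ-sound σ≈σ' i u ×-⇔ ≈ᵀ-sound τ≈τ' i u
  ≈ᵀ-sound ∩-idem i u = mk⇔ proj₁ (λ ↓u → ↓u , ↓u)
  ≈ᵀ-sound ∩-comm i u = mk⇔ swap swap
  ≈ᵀ-sound ∩-assoc i u = mk⇔ assocʳ′ assocˡ′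

  ⋂-realized : ∀ {k} {f : Fin (suc k) → Ty T} {i u} → (∀ c → ⟦ f c ⟧ i u) → ⟦ ⋂ f ⟧ i u
  ⋂-realized {zero} ↓f = ↓f Fin.zero
  ⋂-realized {suc k} ↓f = ↓f Fin.zero , ⋂-realized (λ c → ↓f (Fin.suc c))

  neutral-realizes₂ : ∀ {σ τ υ i m} →
    (∀ {w u} → ⟦ σ ⟧ i w → ⟦ τ ⟧ i u → ⟦ υ ⟧ i (neu (ap (ap m w) u))) → ⟦ σ ⇒ τ ⇒ υ ⟧ i (neu m)
  neutral-realizes₂ k w ↓w = _ , ane , λ u ↓u → _ , ane , k ↓w ↓u

  ⟦_⟧ᶜ : Ctx T → W → Env → Set
  ⟦ Γ ⟧ᶜ i ρ = ∀ x {τ} → Γ x ≡ just τ → ⟦ τ ⟧ i (ρ x)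

  ⟦⟧ᶜ-extend : ∀ {Γ i ρ x σ w} → ⟦ Γ ⟧ᶜ i ρ → ⟦ σ ⟧ i w → ⟦ Γ , x ∶ σ ⟧ᶜ i (ρ [ x ↦ w ])
  ⟦⟧ᶜ-extend {x = x} ↓ρ ↓w z Γz with z ≟N x
  ⟦⟧ᶜ-extend ↓ρ ↓w z refl | yes _ = ↓w
  ... | no _ = ↓ρ z Γz

  sound : ∀ {Γ M σ i ρ} → Γ ⊢ M ∶ σ → ⟦ Γ ⟧ᶜ i ρ → ∃[ u ] Eval ρ M u × ⟦ σ ⟧ i u
  sound {ρ = ρ} (ax {x} Γx) ↓ρ = ρ x , evar , ↓ρ x Γx
  sound {ρ = ρ} (→I {x} {M = M} ⊢M) ↓ρ = clo x M ρ , elam , λ w ↓w →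
    let u , M⇓ , ↓u = sound ⊢M (⟦⟧ᶜ-extend ↓ρ ↓w) in u , aclo M⇓ , ↓u
  sound (→E ⊢M ⊢N) ↓ρ with sound ⊢M ↓ρ | sound ⊢N ↓ρ
  ... | f , M⇓ , ↓f | w , N⇓ , ↓w = let u , f·w , ↓u = ↓f w ↓w in u , eapp M⇓ N⇓ f·w , ↓u
  sound (∩I ⊢σ ⊢τ) ↓ρ with sound ⊢σ ↓ρ | sound ⊢τ ↓ρ
  ... | u , M⇓ , ↓σ | u' , M⇓' , ↓τ with eval-deterministic M⇓ M⇓'
  ... | refl = u , M⇓ , ↓σ , ↓τ
  sound (∩E₁ ⊢M) ↓ρ = let u , M⇓ , ↓σ , _ = sound ⊢M ↓ρ in u , M⇓ , ↓σ
  sound (∩E₂ ⊢M) ↓ρ = let u , M⇓ , _ , ↓τ = sound ⊢M ↓ρ in u , M⇓ , ↓τ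
  sound {i = i} (conv ⊢M σ≈τ) ↓ρ =
    let u , M⇓ , ↓σ = sound ⊢M ↓ρ in u , M⇓ , to (≈ᵀ-sound σ≈τ i u) ↓σ

module Acceptance (T : TM) (n : ℕ) where
  open TM T
  open Evaluation T

  -- Cell i sees the wire y_{i-1} on its left as r and the wire y_i on its right as l, so a move
  -- in direction d crosses a wire that the departure cell sees as exitSide d and the arrival
  -- cell as entrySide d.
  exitSide entrySide : Dir → Atom T
  exitSide plus1 = l
  exitSide minus1 = r
  entrySide plus1 = r
  entrySide minus1 = l

  exit≢entry : ∀ d → exitSide d ≢ entrySide d
  exit≢entry plus1 ()
  exit≢entry minus1 ()

  entry≢• : ∀ d → entrySide d ≢ •
  entry≢• plus1 ()
  entry≢• minus1 ()

  σmove : State T → Sym T → Dir → State T → Sym T → Ty T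
  σmove q' c' d q c =
    ⋂ (λ a → atom • ⇒ atom (sym a) ⇒ atom (sym a))
    ∩ (atom (exitSide d) ⇒ atom (sym c') ⇒ atom (st q c))
    ∩ ⋂ (λ a → atom (entrySide d) ⇒ atom (st q' a) ⇒ atom (sym a))

  σtrans≡σmove : ∀ {q' c' q c} d → σtrans T q' c' d q c ≡ σmove q' c' d q c
  σtrans≡σmove plus1 = refl
  σtrans≡σmove minus1 = refl

  σt≡σmove : ∀ {q c q' c' d} → δ q c ≡ (q' , c' , d) → σt T q c ≡ σmove q' c' d q c
  σt≡σmove {q} {c} eq with δ q c
  σt≡σmove {d = d} refl | _ = σtrans≡σmove d

  Γᵢ-xt : ∀ {i q c} → q ≢ qf → Γᵢ T n i (xt q c) ≡ just (σt T q c)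
  Γᵢ-xt {q = q} q≢qf with q FinP.≟ qf
  ... | yes q≡qf = ⊥-elim (q≢qf q≡qf)
  ... | no _ = refl

  Wire : Fin n → ℕ → Atom T → Set
  Wire i j a = Γᵢ T n i (y j) ≡ just (atom a)

  data WireView (i : Fin n) (j : ℕ) : Maybe (Ty T) → Set where
    absent : ¬ j < n ∸ 1 → WireView i j nothing
    seen-r : j < n ∸ 1 → suc j ≡ toℕ i → WireView i j (just (atom r))
    seen-l : j < n ∸ 1 → j ≡ toℕ i → WireView i j (just (atom l))
    seen-• : j < n ∸ 1 → suc j ≢ toℕ i → j ≢ toℕ i → WireView i j (just (atom •))

  wireView : ∀ i j → WireView i j (Γᵢ T n i (y j))
  wireView i j with j ℕP.<? n ∸ 1
  ... | no j≮ = absent j≮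
  ... | yes j< with suc j ℕP.≟ toℕ i
  ...   | yes sj≡i = seen-r j< sj≡i
  ...   | no sj≢i with j ℕP.≟ toℕ i
  ...     | yes j≡i = seen-l j< j≡i
  ...     | no j≢i = seen-• j< sj≢i j≢i

  wire-functional : ∀ {i j a b} → Wire i j a → Wire i j b → a ≡ b
  wire-functional w w' with trans (≡-sym w) w'
  ... | refl = refl

  wire-bound : ∀ {i j τ} → Γᵢ T n i (y j) ≡ just τ → j < n ∸ 1
  wire-bound {i} {j} Γy with Γᵢ T n i (y j) | wireView i j
  wire-bound refl | _ | seen-r j< _ = j<
  wire-bound refl | _ | seen-l j< _ = j<
  wire-bound refl | _ | seen-• j< _ _ = j<

  wire-atom : ∀ {i j τ} → Γᵢ T n i (y j) ≡ just τ → ∃[ a ] τ ≡ atom a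
  wire-atom {i} {j} Γy with Γᵢ T n i (y j) | wireView i j
  wire-atom refl | _ | seen-r _ _ = r , refl
  wire-atom refl | _ | seen-l _ _ = l , refl
  wire-atom refl | _ | seen-• _ _ _ = • , refl

  wire-not-state : ∀ {i j q c} → ¬ Wire i j (st q c)
  wire-not-state {i} {j} w with Γᵢ T n i (y j) | wireView i j
  wire-not-state () | _ | absent _
  wire-not-state () | _ | seen-r _ _
  wire-not-state () | _ | seen-l _ _
  wire-not-state () | _ | seen-• _ _ _

  wire-r : ∀ {i j} → j < n ∸ 1 → suc j ≡ toℕ i → Wire i j r
  wire-r {i} {j} j< sj≡i with Γᵢ T n i (y j) | wireView i j
  ... | _ | absent j≮ = ⊥-elim (j≮ j<)
  ... | _ | seen-r _ _ = refl
  ... | _ | seen-l _ j≡i = ⊥-elim (ℕP.1+n≢n (trans sj≡i (≡-sym j≡i)))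
  ... | _ | seen-• _ sj≢i _ = ⊥-elim (sj≢i sj≡i)

  wire-l : ∀ {i j} → j < n ∸ 1 → j ≡ toℕ i → Wire i j l
  wire-l {i} {j} j< j≡i with Γᵢ T n i (y j) | wireView i j
  ... | _ | absent j≮ = ⊥-elim (j≮ j<)
  ... | _ | seen-r _ sj≡i = ⊥-elim (ℕP.1+n≢n (trans sj≡i (≡-sym j≡i)))
  ... | _ | seen-l _ _ = refl
  ... | _ | seen-• _ _ j≢i = ⊥-elim (j≢i j≡i)

  wire-• : ∀ {i j} → j < n ∸ 1 → suc j ≢ toℕ i → j ≢ toℕ i → Wire i j •
  wire-• {i} {j} j< sj≢i j≢i with Γᵢ T n i (y j) | wireView i j
  ... | _ | absent j≮ = ⊥-elim (j≮ j<)
  ... | _ | seen-r _ sj≡i = ⊥-elim (sj≢i sj≡i)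
  ... | _ | seen-l _ j≡i = ⊥-elim (j≢i j≡i)
  ... | _ | seen-• _ _ _ = refl

  wire-r⁻¹ : ∀ {i j} → Wire i j r → suc j ≡ toℕ i
  wire-r⁻¹ {i} {j} w with Γᵢ T n i (y j) | wireView i j
  wire-r⁻¹ refl | _ | seen-r _ sj≡i = sj≡i

  wire-l⁻¹ : ∀ {i j} → Wire i j l → j ≡ toℕ i
  wire-l⁻¹ {i} {j} w with Γᵢ T n i (y j) | wireView i j
  wire-l⁻¹ refl | _ | seen-l _ j≡i = j≡i

  Move : Dir → Fin n → Fin n → Set
  Move plus1 p p' = toℕ p' ≡ suc (toℕ p)
  Move minus1 p p' = suc (toℕ p') ≡ toℕ p

  step : ∀ {q p s q' c' d p'} → q ≢ qf → δ q (lookup s p) ≡ (q' , c' , d) → Move d p p' →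
         Step T (cfg q p s) (cfg q' p' (s [ p ]≔ c'))
  step {d = plus1} = stepR
  step {d = minus1} = stepL

  Crossing : Dir → Fin n → Fin n → ℕ → Set
  Crossing d p p' j = Wire p j (exitSide d) × Wire p' j (entrySide d)

  move⇒crossing : ∀ {p p'} d → Move d p p' → ∃[ j ] Crossing d p p' j
  move⇒crossing {p} {p'} plus1 p'≡1+p = toℕ p , wire-l j< refl , wire-r j< (≡-sym p'≡1+p)
    where j< = suc<⇒<∸1 (subst (_< n) p'≡1+p (FinP.toℕ<n p'))
  move⇒crossing {p} {p'} minus1 1+p'≡p = toℕ p' , wire-r j< 1+p'≡p , wire-l j< refl
    where j< = suc<⇒<∸1 (subst (_< n) (≡-sym 1+p'≡p) (FinP.toℕ<n p))

  crossing⇒move : ∀ {p p' j} d → Crossing d p p' j → Move d p p'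
  crossing⇒move plus1 (exit , entry) = trans (≡-sym (wire-r⁻¹ entry)) (cong suc (wire-l⁻¹ exit))
  crossing⇒move minus1 (exit , entry) = trans (cong suc (≡-sym (wire-l⁻¹ entry))) (wire-r⁻¹ exit)

  exit⇒crossing : ∀ {p j} d → Wire p j (exitSide d) → ∃[ p' ] Crossing d p p' j
  exit⇒crossing plus1 exit =
    fromℕ< (<∸1⇒suc< j<) , exit , wire-r j< (≡-sym (FinP.toℕ-fromℕ< _))
    where j< = wire-bound exit
  exit⇒crossing minus1 exit =
    fromℕ< (ℕP.<-trans (ℕP.n<1+n _) (<∸1⇒suc< j<)) , exit , wire-l j< (≡-sym (FinP.toℕ-fromℕ< _))
    where j< = wire-bound exit

  crossing-distinct : ∀ {p p' j} d → Crossing d p p' j → p ≢ p'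
  crossing-distinct d (exit , entry) refl = exit≢entry d (wire-functional exit entry)

  entry-unique : ∀ {i p p' j} d → Crossing d p p' j → Wire i j (entrySide d) → i ≡ p'
  entry-unique plus1 (_ , entry) w = FinP.toℕ-injective (trans (≡-sym (wire-r⁻¹ w)) (wire-r⁻¹ entry))
  entry-unique minus1 (_ , entry) w = FinP.toℕ-injective (trans (≡-sym (wire-l⁻¹ w)) (wire-l⁻¹ entry))

  idle-elsewhere : ∀ {i p p' j} d → Crossing d p p' j → i ≢ p → i ≢ p' → Wire i j •
  idle-elsewhere plus1 (exit , entry) i≢p i≢p' = wire-• (wire-bound exit)
    (λ e → i≢p' (FinP.toℕ-injective (trans (≡-sym e) (wire-r⁻¹ entry))))
    (λ e → i≢p (FinP.toℕ-injective (trans (≡-sym e) (wire-l⁻¹ exit))))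
  idle-elsewhere minus1 (exit , entry) i≢p i≢p' = wire-• (wire-bound exit)
    (λ e → i≢p (FinP.toℕ-injective (trans (≡-sym e) (wire-r⁻¹ exit))))
    (λ e → i≢p' (FinP.toℕ-injective (trans (≡-sym e) (wire-l⁻¹ entry))))

  Typable : State T → Fin n → Vec (Sym T) n → Set
  Typable q p s = ∃[ e ] (Γᵢ T n p ⊢ e ∶ atom (st q (lookup s p)))
                       × (∀ i → i ≢ p → Γᵢ T n i ⊢ e ∶ atom (sym (lookup s i)))

  final-typable : ∀ {p s} → Typable qf p s
  final-typable {p} {s} =
    var xf , ⋂-elim (∩E₁ (ax refl)) (lookup s p) , λ i _ → ⋂-elim (∩E₂ (ax refl)) (lookup s i)

  step-typable : ∀ {q p s q' c' d p' j} → q ≢ qf → δ q (lookup s p) ≡ (q' , c' , d) →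
                 Crossing d p p' j → Typable q' p' (s [ p ]≔ c') → Typable q p s
  step-typable {q} {p} {s} {q'} {c'} {d} {p'} {j} q≢qf δqa crossing (e , ⊢e-head , ⊢e-sym) =
    e' , ⊢e'-head , ⊢e'-sym
    where
      p≢p' = crossing-distinct d crossing
      e' = app (app (var (xt q (lookup s p))) (var (y j))) e

      ⊢xt : ∀ {i} → Γᵢ T n i ⊢ var (xt q (lookup s p)) ∶ σmove q' c' d q (lookup s p)
      ⊢xt {i} = retype (σt≡σmove {q} {lookup s p} δqa) (ax (Γᵢ-xt {i} q≢qf))

      ⊢e'-head : Γᵢ T n p ⊢ e' ∶ atom (st q (lookup s p))
      ⊢e'-head = →E (→E (∩E₂ (∩E₁ ⊢xt)) (ax (proj₁ crossing)))
                    (retype (cong (atom ∘′ sym) (lookup∘update p s c')) (⊢e-sym p p≢p'))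

      ⊢e'-sym : ∀ i → i ≢ p → Γᵢ T n i ⊢ e' ∶ atom (sym (lookup s i))
      ⊢e'-sym i i≢p with i FinP.≟ p'
      ... | yes refl = →E (→E (⋂-elim (∩E₂ ⊢xt) (lookup s p')) (ax (proj₂ crossing)))
                          (retype (cong (atom ∘′ st q') (lookup∘update′ (p≢p' ∘′ ≡-sym) s c')) ⊢e-head)
      ... | no i≢p' = →E (→E (⋂-elim (∩E₁ (∩E₁ ⊢xt)) (lookup s i))
                                (ax (idle-elsewhere d crossing i≢p i≢p')))
                         (retype (cong (atom ∘′ sym) (lookup∘update′ i≢p s c')) (⊢e-sym i i≢p'))

  accepting⇒typable : ∀ {q p s C} → Star (Step T) (cfg q p s) C → Config.state C ≡ qf → Typable q p s
  accepting⇒typable {s = s} ε refl = final-typable {s = s}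
  accepting⇒typable {s = s} (stepR q≢qf δqa move ◅ run) halts =
    step-typable {s = s} q≢qf δqa (proj₂ (move⇒crossing plus1 move)) (accepting⇒typable run halts)
  accepting⇒typable {s = s} (stepL q≢qf δqa move ◅ run) halts =
    step-typable {s = s} q≢qf δqa (proj₂ (move⇒crossing minus1 move)) (accepting⇒typable run halts)

  yᵛ : ℕ → Val
  yᵛ j = neu (hd (y j))

  xtᵛ : State T → Sym T → Val → Val → Val
  xtᵛ q c w u = neu (ap (ap (hd (xt q c)) w) u)

  -- Realizers are traces x_t w (x_t w' (… x_f)) of accepting runs: in x_t w u, w is the wire
  -- crossed by the first move and u realizes the successor configuration at the same cell.
  data Realizes (i : Fin n) : Atom T → Val → Set where
    wire        : ∀ {j a} → Wire i j a → Realizes i a (yᵛ j)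
    final-state : ∀ {c} → Realizes i (st qf c) (neu (hd xf))
    final-sym   : ∀ {c} → Realizes i (sym c) (neu (hd xf))
    idle   : ∀ {q c a w u} → Realizes i • w → Realizes i (sym a) u → Realizes i (sym a) (xtᵛ q c w u)
    depart : ∀ {q c q' c' d w u} → q ≢ qf → δ q c ≡ (q' , c' , d) →
             Realizes i (exitSide d) w → Realizes i (sym c') u → Realizes i (st q c) (xtᵛ q c w u)
    arrive : ∀ {q c q' c' d a w u} → δ q c ≡ (q' , c' , d) →
             Realizes i (entrySide d) w → Realizes i (st q' a) u → Realizes i (sym a) (xtᵛ q c w u)

  open Realizability T Realizes

  wire-realizer : ∀ {i j a} → Realizes i a (yᵛ j) → Wire i j a
  wire-realizer (wire w) = w

  exit-realizer : ∀ {i w} d → Realizes i (exitSide d) w → ∃[ j ] w ≡ yᵛ j × Wire i j (exitSide d)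
  exit-realizer plus1 (wire w) = _ , refl , w
  exit-realizer minus1 (wire w) = _ , refl , w

  move-realizes : ∀ {i q c q' c' d} → q ≢ qf → δ q c ≡ (q' , c' , d) →
                  ⟦ σmove q' c' d q c ⟧ i (neu (hd (xt q c)))
  move-realizes q≢qf δqc =
    ( ⋂-realized {nΣ} (λ _ → neutral-realizes₂ idle)
    , neutral-realizes₂ (depart q≢qf δqc) )
    , ⋂-realized {nΣ} (λ _ → neutral-realizes₂ (arrive δqc))

  xt-realizes : ∀ {i q c} → q ≢ qf → ⟦ σt T q c ⟧ i (neu (hd (xt q c)))
  xt-realizes {i} {q} {c} q≢qf with δ q c in δqc
  ... | q' , c' , d =
    subst (λ τ → ⟦ τ ⟧ i (neu (hd (xt q c)))) (≡-sym (σtrans≡σmove d)) (move-realizes q≢qf δqc)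

  variables-realize-Γᵢ : ∀ i → ⟦ Γᵢ T n i ⟧ᶜ i (λ x → neu (hd x))
  variables-realize-Γᵢ i xf refl = ⋂-realized {nΣ} (λ _ → final-state) , ⋂-realized {nΣ} (λ _ → final-sym)
  variables-realize-Γᵢ i (xt q c) Γx with q FinP.≟ qf
  variables-realize-Γᵢ i (xt q c) refl | no q≢qf = xt-realizes q≢qf
  variables-realize-Γᵢ i (y j) Γy with wire-atom Γy
  ... | a , refl = wire Γy

  -- Terminates by structural recursion on the implicit value u, which loses its outer x_t w.
  realizers⇒accepting : ∀ {q p s u} → Realizes p (st q (lookup s p)) u →
                        (∀ i → i ≢ p → Realizes i (sym (lookup s i)) u) → Accepting T q p s
  realizers⇒accepting (wire w) _ = ⊥-elim (wire-not-state w)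
  realizers⇒accepting {p = p} {s} final-state _ = cfg qf p s , ε , refl
  realizers⇒accepting {q} {p} {s} (depart {q' = q'} {c'} {d} {u = u} q≢qf δqa exitᵣ ↓c') ↓sym
    with exit-realizer d exitᵣ
  ... | j , refl , exit with exit⇒crossing d exit
  ...   | p' , crossing =
    let C , run , halts = realizers⇒accepting ↓head ↓sym'
    in C , step q≢qf δqa (crossing⇒move d crossing) ◅ run , halts
    where
      p'≢p = crossing-distinct d crossing ∘′ ≡-sym
      s' = s [ p ]≔ c'

      ↓head : Realizes p' (st q' (lookup s' p')) u
      ↓head with ↓sym p' p'≢p
      ... | idle ↓• _ = ⊥-elim (entry≢• d (wire-functional (proj₂ crossing) (wire-realizer ↓•)))
      ... | arrive δqa' _ ↓st with trans (≡-sym δqa) δqa'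
      ...   | refl = subst (λ a → Realizes p' (st q' a) u) (≡-sym (lookup∘update′ p'≢p s c')) ↓st

      ↓sym' : ∀ i → i ≢ p' → Realizes i (sym (lookup s' i)) u
      ↓sym' i i≢p' with i FinP.≟ p
      ... | yes refl = subst (λ a → Realizes p (sym a) u) (≡-sym (lookup∘update p s c')) ↓c'
      ... | no i≢p with ↓sym i i≢p
      ...   | idle _ ↓a = subst (λ a → Realizes i (sym a) u) (≡-sym (lookup∘update′ i≢p s c')) ↓a
      ...   | arrive δqa' entryᵣ _ with trans (≡-sym δqa) δqa'
      ...     | refl = ⊥-elim (i≢p' (entry-unique d crossing (wire-realizer entryᵣ)))

  typable⇒accepting : ∀ {q p s} → Typable q p s → Accepting T q p s
  typable⇒accepting {p = p} {s} (e , ⊢head , ⊢sym) with sound ⊢head (variables-realize-Γᵢ p)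
  ... | u , e⇓u , ↓head = realizers⇒accepting ↓head ↓sym
    where
      ↓sym : ∀ i → i ≢ p → Realizes i (sym (lookup s i)) u
      ↓sym i i≢p with sound (⊢sym i i≢p) (variables-realize-Γᵢ i)
      ... | u' , e⇓u' , ↓u' rewrite eval-deterministic e⇓u e⇓u' = ↓u'

mainTheorem2 : (T : TM) (n : ℕ) → 2 ≤ n →
    (q : State T) (s : Vec (Sym T) n) (p : Fin n) →
    Accepting T q p s ⇔
      ∃ λ (e : Term T) →
        (Γᵢ T n p ⊢ e ∶ atom (st q (lookup s p)))
        × (∀ (i : Fin n) → i ≢ p → Γᵢ T n i ⊢ e ∶ atom (sym (lookup s i)))
mainTheorem2 T n _ q s p = mk⇔
  (λ (_ , run , halts) → accepting⇒typable run halts)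
  typable⇒accepting
  where open Acceptance T n
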